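{- Let $\ell\in\{1,\dots,k\}$, let $H\subseteq M$ be a set of at most $k-\ell$ points, let $P$ be an $(\ell,H)$-phase with demand vector $v$, let $\mathcal{C}=[C_0,\dots,C_m]$ be an $(\ell-1)$-active solution to the request sequence of $P$, and let $\ell'\in\{\ell+1,\dots,k\}$. If $\mathcal{C}$ is $\ell'$-contaminated for $P$, then \[\frac{v[C_0[\ell']]}{|v|}\ge\frac{1}{d_\ell\cdot F_{\ell,\ell'}}.\]
   Context: Fix an integer $k\ge1$, a set $M$ of points, and weights $0<w_1<w_2<\cdots<w_k$ such that for each $i\in\{2,\dots,k\}$, $w_i$ is an integer multiple of $w_{i-1}$. Request sequences are finite strings over $M$; $\rho_1\rho_2$ denotes concatenation. A finite set of strings is a prefix chain if for any two of its strings one is a prefix of the other. Vectors are non-negative real vectors indexed by $M$ (finitely supported); $v[p]$ is the coordinate at $p$; $u_p$ is the vector with $1$ at coordinate $p$ and $0$ elsewhere; $|v|$ is the sum of the entries of $v$; $\mathrm{top}_d(v)$ is the set of $d$ points with the $d$ largest coordinates of $v$, ties broken by a fixed total order on $M$. Let $d_\ell=2^{5^{\ell-1}-1}$. For integers $1\le\ell\le\ell'$, define $F_{1,\ell'}=1$ and $F_{\ell,\ell'}=2^{\ell'-\ell+3}\cdot d_{\ell-1}\cdot F_{\ell-1,\ell'}$ for $\ell>1$. Phases (simultaneous induction on $\ell$; $H$ always a set of at most $k-\ell$ points). (i) A $(1,H)$-phase is a string $\rho$ over $H\cup\{p\}$, for some $p\notin H$, containing at least one occurrence of $p$; request sequence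 $\rho$, demand vector $u_p$, critical set $\{p\}$. (ii) For $\ell<k$, an $(\ell,H)$-multiphase is a sequence $P_1,\dots,P_n$ of $(\ell,H)$-phases, $n=w_{\ell+1}/w_\ell$ (its constituent phases), with request sequences $\rho_i$, such that each $\rho_i$ is the longest prefix of $\rho_i\cdots\rho_n$ that is the request sequence of some $(\ell,H)$-phase; request sequence $\rho_1\cdots\rho_n$, demand vector $v=\sum_i v_i$ ($v_i$ the demand vector of $P_i$), critical set $\mathrm{top}_{d_{\ell+1}-1}(v)$. (iii) For $\ell\ge2$, an $(\ell,H)$-phase is a pair $(Q^0,\mathcal{Q})$: $Q^0$ is an $(\ell-1,H)$-multiphase with request sequence $\rho^0$, demand vector $v^0$, critical set $S$; $\mathcal{Q}=\{Q^p:p\in S\}$ with each $Q^p$ an $(\ell-1,H\cup\{p\})$-multiphase with request sequence $\rho^p$ and demand vector $v^p$, such that $\{\rho^p\}$ is a prefix chain with longest string $\rho'$, $\rho^0$ is the longest prefix of $\rho^0\rho'$ that is the request sequence of some $(\ell-1,H)$-multiphase, and each $\rho^p$ is the longest prefix of $\rho'$ that is the request sequence of some $(\ell-1,H\cup\{p\})$-multiphase. Request sequence $\rho^0\rho'$, critical set $S$, demand vector $v^0+\sum_{p\in S}v^p$. Solutions. A configuration is a $k$-tuple $C=(C[1],\dots,C[k])$ of points. A solution to $\rho=r_1\cdots r_m$ is a sequence $\mathcal{C}=[C_0,\dots,C_m]$ of configurations ($C_0$ arbitrary) such that for each $i\ge1$, $r_i=C_i[j]$ for some $j$. For $0\le i\le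 j\le m$, $\mathcal{C}[i,j]=[C_i,\dots,C_j]$. $\mathcal{C}$ is $t$-active if $C_0[j]=\cdots=C_m[j]$ for all $j\in\{t+1,\dots,k\}$. Restriction. For $\ell\ge2$ and an $(\ell,H)$-phase $P=(Q^0,\mathcal{Q})$ with request sequence $\rho=\rho^0\rho'$, the constituent phases of $Q^0$ occupy, in order, consecutive blocks of the prefix $\rho^0$ of $\rho$, and the constituent phases of each $Q^p$ occupy, in order, consecutive blocks of $\rho$ starting right after $\rho^0$. If such a constituent phase $P'$ occupies positions $i+1,\dots,j$ of $\rho$ and $\mathcal{C}$ is a solution to $\rho$, the restriction of $\mathcal{C}$ to $P'$ is $\mathcal{C}[i,j]$. Hard multiphase. For $\ell\ge2$, an $(\ell,H)$-phase $P$ with critical set $S$, and an $(\ell-1)$-active solution $\mathcal{C}$ to its request sequence, the hard multiphase of $P$ for $\mathcal{C}$ is $Q^0$ if $C_0[\ell]\notin S$, and $Q^{C_0[\ell]}$ if $C_0[\ell]\in S$. Contamination. Let $P$ be an $(\ell,H)$-phase ($\ell\in\{1,\dots,k\}$) with demand vector $v$, $\mathcal{C}$ an $(\ell-1)$-active solution to its request sequence, and $\ell'\in\{\ell+1,\dots,k\}$. $\mathcal{C}$ is $\ell'$-contaminated for $P$ if either $\ell=1$ and $v[C_0[\ell']]=1$; or $\ell>1$ and at least $2^{ -(\ell'-\ell+3)}\cdot(w_\ell/w_{\ell-1})$ of the $w_\ell/w_{\ell-1}$ constituent phases $P'$ of the hard multiphase of $P$ for $\mathcal{C}$ are such that the restriction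 of $\mathcal{C}$ to $P'$ is $(\ell-2)$-active and $\ell'$-contaminated for $P'$. -}

module Defs where

open import Level using (0ℓ)
open import Data.Nat using (ℕ; zero; suc; _+_; _*_; _∸_; _^_; _≤_; _<_)
open import Data.Fin using (Fin; toℕ)
open import Data.Product using (Σ; ∃; _×_; _,_)
open import Data.Sum using (_⊎_)
open import Data.Maybe using (Maybe; just; nothing)
open import Data.List using (List; []; _∷_; _++_; length; filter; concat; tabulate; drop; take; lookup)
open import Data.List.Relation.Unary.All using (All)
open import Data.List.Relation.Unary.Any using (index)
open import Data.List.Relation.Binary.Pointwise using (Pointwise)
import Data.List.Relation.Unary.Unique.Propositional as UniqueP
open import Data.Vec using (Vec; toList)
import Data.Vec as Vec
import Data.Vec.Membership.Propositional as VecMem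
open import Relation.Binary using (Rel; IsStrictTotalOrder)
open import Relation.Binary.Definitions using (DecidableEquality)
open import Relation.Binary.PropositionalEquality using (_≡_)
open import Relation.Nullary using (¬_; yes; no)

-- Global data: the point set M (with decidable equality and the fixed
-- total order used for tie-breaking), k, and the weight ratios
-- ratio i = w_{i+1} / w_i  (i = 1, ..., k-1), which are integers >= 2
-- because 0 < w_1 < ... < w_k and w_{i-1} | w_i.

record Setting : Set₁ where
  field
    M         : Set
    _≟_       : DecidableEquality M
    _≺_       : Rel M 0ℓ
    ≺-isSTO   : IsStrictTotalOrder _≡_ _≺_
    k         : ℕ
    ratio     : ℕ → ℕ
    ratio-≥2  : ∀ i → 1 ≤ i → i < k → 2 ≤ ratio i

d : ℕ → ℕ
d ℓ = 2 ^ (5 ^ (ℓ ∸ 1) ∸ 1)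

F : ℕ → ℕ → ℕ
F zero          ℓ' = 1
F (suc zero)    ℓ' = 1
F (suc (suc i)) ℓ' = 2 ^ (ℓ' ∸ suc (suc i) + 3) * d (suc i) * F (suc i) ℓ'

module Setup (𝒮 : Setting) where
  open Setting 𝒮 public
  open import Data.List.Membership.Propositional using (_∈_; _∉_)
  open import Data.List.Membership.DecPropositional _≟_ using (_∈?_)

  Unique : List M → Set
  Unique = UniqueP.Unique

  -- Vectors: every vector occurring here (demand vectors) is a finite
  -- sum of unit vectors u_p, hence is represented as the multiset (list)
  -- of the points p; v[p] is the multiplicity, |v| the length,
  -- u_p = p ∷ [], and vector addition is concatenation.
  Vector : Set
  Vector = List M

  _[_] : Vector → M → ℕ
  v [ p ] = length (filter (p ≟_) v)

  ∣_∣ : Vector → ℕ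
  ∣ v ∣ = length v

  IsTop : ℕ → Vector → List M → Set
  IsTop n v S = Unique S × length S ≡ n ×
    (∀ p q → p ∈ S → q ∉ S → (v [ q ] < v [ p ]) ⊎ ((v [ q ] ≡ v [ p ]) × (p ≺ q)))

  Prefix : List M → List M → Set
  Prefix σ τ = ∃ λ σ' → σ ++ σ' ≡ τ

  LongestPrefix : (List M → Set) → List M → List M → Set
  LongestPrefix R σ τ = Prefix σ τ × R σ ×
    (∀ σ' → Prefix σ' τ → length σ < length σ' → ¬ R σ')

  record LevelData : Set₁ where
    field
      Ph  : List M → Set
      req : ∀ {H} → Ph H → List M
      dem : ∀ {H} → Ph H → Vector
  open LevelData

  IsReqOf : LevelData → List M → List M → Set
  IsReqOf L H ρ = Σ (Ph L H) λ P → req L P ≡ ρ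

  reqsOf : (L : LevelData) {H : List M} {n : ℕ} → (Fin n → Ph L H) → List (List M)
  reqsOf L ps = tabulate (λ j → req L (ps j))

  record Multi (L : LevelData) (n e : ℕ) (H : List M) : Set where
    field
      parts    : Fin n → Ph L H
      longest  : ∀ j → LongestPrefix (IsReqOf L H) (req L (parts j))
                                     (concat (drop (toℕ j) (reqsOf L parts)))
      crit     : List M
      crit-top : IsTop e (concat (tabulate (λ j → dem L (parts j)))) crit

  mreq : ∀ {L n e H} → Multi L n e H → List M
  mreq {L} Q = concat (reqsOf L (Multi.parts Q))

  mdem : ∀ {L n e H} → Multi L n e H → Vector
  mdem {L} Q = concat (tabulate (λ j → dem L (Multi.parts Q j)))

  multiLD : LevelData → ℕ → ℕ → LevelData
  multiLD L n e = record { Ph = Multi L n e ; req = mreq ; dem = mdem }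

  record Step (L : LevelData) (n e : ℕ) (H : List M) : Set where
    field
      Q0     : Multi L n e H
      Q      : (i : Fin (length (Multi.crit Q0))) →
               Multi L n e (lookup (Multi.crit Q0) i ∷ H)
      ρ'     : List M
      chain  : ∀ i j → Prefix (mreq (Q i)) (mreq (Q j)) ⊎ Prefix (mreq (Q j)) (mreq (Q i))
      ρ'-max : (∃ λ i → mreq (Q i) ≡ ρ') × (∀ i → length (mreq (Q i)) ≤ length ρ')
      long0  : LongestPrefix (IsReqOf (multiLD L n e) H) (mreq Q0) (mreq Q0 ++ ρ')
      longp  : ∀ i → LongestPrefix (IsReqOf (multiLD L n e) (lookup (Multi.crit Q0) i ∷ H))
                                   (mreq (Q i)) ρ'

  stepLD : LevelData → ℕ → ℕ → LevelData
  stepLD L n e = record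
    { Ph  = Step L n e
    ; req = λ P → mreq (Step.Q0 P) ++ Step.ρ' P
    ; dem = λ P → mdem (Step.Q0 P) ++ concat (tabulate (λ i → mdem (Step.Q P i)))
    }

  record Base (H : List M) : Set where
    field
      p    : M
      p∉H  : p ∉ H
      ρ    : List M
      over : All (λ x → x ≡ p ⊎ x ∈ H) ρ
      occ  : p ∈ ρ

  baseLD : LevelData
  baseLD = record { Ph = Base ; req = Base.ρ ; dem = λ P → Base.p P ∷ [] }

  -- level i = the (i+1)-phases
  level : ℕ → LevelData
  level zero    = baseLD
  level (suc i) = stepLD (level i) (ratio (suc i)) (d (suc (suc i)) ∸ 1)

  Phase : ℕ → List M → Set
  Phase ℓ H = Ph (level (ℓ ∸ 1)) H

  requests : ∀ ℓ {H} → Phase ℓ H → List M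
  requests ℓ P = req (level (ℓ ∸ 1)) P

  demand : ∀ ℓ {H} → Phase ℓ H → Vector
  demand ℓ P = dem (level (ℓ ∸ 1)) P

  -- A sequence [C_0, ..., C_m] is given as
  -- C_0 together with the list [C_1, ..., C_m].  Coordinate j (1-based)
  -- of a configuration C is  Vec.lookup C j'  with toℕ j' = j - 1.

  Config : Set
  Config = Vec M k

  IsSolution : List M → Config → List Config → Set
  IsSolution ρ C₀ Cs = Pointwise (λ r C → r VecMem.∈ C) ρ Cs

  -- t-active: coordinates t+1..k (0-based indices ≥ t) constant
  Active : ℕ → Config → List Config → Set
  Active t C₀ Cs = ∀ C → C ∈ Cs → ∀ (j : Fin k) → t ≤ toℕ j → Vec.lookup C j ≡ Vec.lookup C₀ j

  nthC : Config → List Config → ℕ → Config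
  nthC C₀ Cs       zero    = C₀
  nthC C₀ []       (suc i) = C₀
  nthC C₀ (C ∷ Cs) (suc i) = nthC C Cs i

  -- restriction to positions a+1 .. a+len, i.e. C[a, a+len]
  restrict : Config → List Config → ℕ → ℕ → Config × List Config
  restrict C₀ Cs a len = nthC C₀ Cs a , take len (drop a Cs)

  at : List M → ℕ → Maybe M
  at []       _       = nothing
  at (x ∷ xs) zero    = just x
  at (x ∷ xs) (suc i) = at xs i

  -- hard multiphase, with the offset of its first position in ρ
  hard : ∀ {L n e H} → Step L n e H → Maybe M →
         Σ (List M) λ H' → ℕ × Multi L n e H'
  hard {H = H} P nothing = H , 0 , Step.Q0 P
  hard {H = H} P (just p) with p ∈? Multi.crit (Step.Q0 P)
  ... | yes m = _ , length (mreq (Step.Q0 P)) , Step.Q P (index m)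
  ... | no  _ = H , 0 , Step.Q0 P

  -- contam ℓ' i P C₀ Cs : the solution is ℓ'-contaminated for the
  -- (i+1,H)-phase P; ℓ' is the 0-based index of coordinate ℓ' (so the
  -- paper's ℓ' is suc (toℕ ℓ')).
  contam : (ℓ' : Fin k) (i : ℕ) {H : List M} → Ph (level i) H → Config → List Config → Set
  contam ℓ' zero    P C₀ Cs = dem baseLD P [ Vec.lookup C₀ ℓ' ] ≡ 1
  contam ℓ' (suc i) P C₀ Cs with hard P (at (toList C₀) (suc i))
  ... | H' , off , Qh =
    Σ (List (Fin n)) λ J → UniqueP.Unique J ×
      All (λ j → let R = restrict C₀ Cs (offset j) (length (req (level i) (Multi.parts Qh j)))
                 in Active i (Data.Product.proj₁ R) (Data.Product.proj₂ R)
                    × contam ℓ' i (Multi.parts Qh j) (Data.Product.proj₁ R) (Data.Product.proj₂ R)) J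
      × n ≤ length J * 2 ^ (suc (toℕ ℓ') ∸ suc (suc i) + 3)
    where
    n : ℕ
    n = ratio (suc i)
    offset : Fin n → ℕ
    offset j = off + length (concat (take (toℕ j) (reqsOf (level i) (Multi.parts Qh))))

  Contaminated : (ℓ' : Fin k) (ℓ : ℕ) {H : List M} → Phase ℓ H → Config → List Config → Set
  Contaminated ℓ' ℓ P C₀ Cs = contam ℓ' (ℓ ∸ 1) P C₀ Cs

{-# OPTIONS --safe #-}
-- All (ℓ,H)-phases have demand vectors of one common size s_ℓ, with
-- s_1 = 1 and s_ℓ = d_ℓ · (w_ℓ / w_{ℓ-1}) · s_{ℓ-1}, because a phase consists
-- of d_ℓ multiphases of w_ℓ / w_{ℓ-1} phases each.  Induction on ℓ: an
-- ℓ'-contaminated solution contaminates a 2^{-(ℓ'-ℓ+3)} fraction of the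
-- (distinct) constituent phases of the hard multiphase; since the solution is
-- active, their restrictions start with the same point C₀[ℓ'], so by induction
-- each contributes at least s_{ℓ-1} / (d_{ℓ-1} F_{ℓ-1,ℓ'}) to the coordinate of v at
-- that point, and multiplying out gives s_ℓ / (d_ℓ F_{ℓ,ℓ'}).
module Submission where

open import Defs
open import Data.Nat using (ℕ; zero; suc; _+_; _*_; _∸_; _^_; _≤_; _<_; z≤n)
open import Data.Nat.Properties hiding (_≟_)
open import Data.Nat.ListAction using (sum)
open import Data.Fin using (Fin; toℕ)
import Data.Fin as Fin
open import Data.List using (List; []; _∷_; _++_; length; filter; concat; tabulate; map; allFin; take)
open import Data.List.Properties using (length-++; filter-++; map-tabulate)
open import Data.List.Membership.Propositional using (_∈_)
open import Data.List.Membership.Propositional.Properties using (∈-∃++; ∈-allFin)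
open import Data.List.Relation.Binary.Subset.Propositional using (_⊆_)
open import Data.List.Relation.Unary.All using (All; []; _∷_)
import Data.List.Relation.Unary.All as All
open import Data.List.Relation.Unary.Any using (here; there; index)
open import Data.List.Relation.Unary.AllPairs using (_∷_)
import Data.List.Relation.Unary.Unique.Propositional as UniqueP
open import Data.Product using (_,_; proj₁; proj₂)
open import Data.Sum using (_⊎_; inj₁; inj₂)
open import Data.Maybe using (nothing; just)
open import Relation.Nullary using (yes; no; contradiction)
open import Relation.Binary.PropositionalEquality hiding ([_])
open import Algebra.Properties.CommutativeSemigroup +-commutativeSemigroup
  using () renaming (x∙yz≈y∙xz to +-left-comm)
open import Algebra.Properties.CommutativeSemigroup *-commutativeSemigroup
  using () renaming (x∙yz≈y∙xz to *-left-comm)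
open import Function using (_∘_)
import Data.Vec as Vec

module _ {A : Set} where

  ∈-remove : ∀ xs {x y : A} {ys} → y ∈ xs ++ x ∷ ys → x ≢ y → y ∈ xs ++ ys
  ∈-remove []       (here refl) x≢y = contradiction refl x≢y
  ∈-remove []       (there y∈)  _   = y∈
  ∈-remove (_ ∷ xs) (here refl) _   = here refl
  ∈-remove (_ ∷ xs) (there y∈)  x≢y = there (∈-remove xs y∈ x≢y)

  sum-map-insert : ∀ (g : A → ℕ) xs x ys → sum (map g (xs ++ x ∷ ys)) ≡ g x + sum (map g (xs ++ ys))
  sum-map-insert g []       x ys = refl
  sum-map-insert g (z ∷ xs) x ys =
    trans (cong (g z +_) (sum-map-insert g xs x ys)) (+-left-comm (g z) (g x) _)

  sum-map-mono-⊆ : ∀ (g : A → ℕ) {xs ys} → UniqueP.Unique xs → xs ⊆ ys → sum (map g xs) ≤ sum (map g ys)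
  sum-map-mono-⊆ g {[]}     _               _     = z≤n
  sum-map-mono-⊆ g {x ∷ xs} (x∉xs ∷ xs-uniq) xs⊆ys with ∈-∃++ (xs⊆ys (here refl))
  ... | us , vs , refl = begin
      g x + sum (map g xs)
    ≤⟨ +-monoʳ-≤ (g x) (sum-map-mono-⊆ g xs-uniq xs⊆us++vs) ⟩
      g x + sum (map g (us ++ vs))
    ≡⟨ sum-map-insert g us x vs ⟨
      sum (map g (us ++ x ∷ vs))
    ∎
    where
    open ≤-Reasoning
    xs⊆us++vs : xs ⊆ us ++ vs
    xs⊆us++vs y∈xs = ∈-remove us (xs⊆ys (there y∈xs)) (All.lookup x∉xs y∈xs)

  length*≤sum-map* : ∀ (g : A → ℕ) s D xs → All (λ x → s ≤ g x * D) xs →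
                     length xs * s ≤ sum (map g xs) * D
  length*≤sum-map* g s D []       []       = z≤n
  length*≤sum-map* g s D (x ∷ xs) (b ∷ bs) =
    ≤-trans (+-mono-≤ b (length*≤sum-map* g s D xs bs)) (≤-reflexive (sym (*-distribʳ-+ D (g x) _)))

contamination-arithmetic : ∀ {n j s T V} a b c → n ≤ j * T → j * s ≤ V * (b * c) →
                           a * (n * s) ≤ V * (a * (T * b * c))
contamination-arithmetic {n} {j} {s} {T} {V} a b c n≤jT js≤Vbc = begin
    a * (n * s)
  ≤⟨ *-monoʳ-≤ a (*-monoˡ-≤ s n≤jT) ⟩
    a * (j * T * s)
  ≡⟨ cong (λ x → a * (x * s)) (*-comm j T) ⟩
    a * (T * j * s)
  ≡⟨ cong (a *_) (*-assoc T j s) ⟩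
    a * (T * (j * s))
  ≤⟨ *-monoʳ-≤ a (*-monoʳ-≤ T js≤Vbc) ⟩
    a * (T * (V * (b * c)))
  ≡⟨ cong (a *_) (*-left-comm T V (b * c)) ⟩
    a * (V * (T * (b * c)))
  ≡⟨ *-left-comm a V (T * (b * c)) ⟩
    V * (a * (T * (b * c)))
  ≡⟨ cong (λ x → V * (a * x)) (*-assoc T b c) ⟨
    V * (a * (T * b * c))
  ∎
  where open ≤-Reasoning

d>0 : ∀ ℓ → 0 < d ℓ
d>0 ℓ = m^n>0 2 (5 ^ (ℓ ∸ 1) ∸ 1)

module _ (𝒮 : Setting) where
  open Setup 𝒮
  open LevelData
  open import Data.List.Membership.DecPropositional _≟_ using (_∈?_)

  coord-++ : ∀ u w q → (u ++ w) [ q ] ≡ u [ q ] + w [ q ]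
  coord-++ u w q = trans (cong length (filter-++ (q ≟_) u w)) (length-++ (filter (q ≟_) u))

  coord-++-≤ˡ : ∀ u w q → u [ q ] ≤ (u ++ w) [ q ]
  coord-++-≤ˡ u w q = ≤-trans (m≤m+n _ _) (≤-reflexive (sym (coord-++ u w q)))

  coord-++-≤ʳ : ∀ u w q → w [ q ] ≤ (u ++ w) [ q ]
  coord-++-≤ʳ u w q = ≤-trans (m≤n+m _ _) (≤-reflexive (sym (coord-++ u w q)))

  coord-concat-tabulate : ∀ {n} (f : Fin n → Vector) q →
                          concat (tabulate f) [ q ] ≡ sum (tabulate (λ j → f j [ q ]))
  coord-concat-tabulate {zero}  f q = refl
  coord-concat-tabulate {suc n} f q =
    trans (coord-++ (f Fin.zero) _ q) (cong (f Fin.zero [ q ] +_) (coord-concat-tabulate (f ∘ Fin.suc) q))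

  coord-≤-concat-tabulate : ∀ {n} (f : Fin n → Vector) j q → f j [ q ] ≤ concat (tabulate f) [ q ]
  coord-≤-concat-tabulate f Fin.zero    q = coord-++-≤ˡ (f Fin.zero) _ q
  coord-≤-concat-tabulate f (Fin.suc j) q =
    ≤-trans (coord-≤-concat-tabulate (λ j → f (Fin.suc j)) j q) (coord-++-≤ʳ (f Fin.zero) _ q)

  length-concat-tabulate : ∀ {n} (f : Fin n → Vector) s → (∀ j → ∣ f j ∣ ≡ s) →
                           ∣ concat (tabulate f) ∣ ≡ n * s
  length-concat-tabulate {zero}  f s ∣f∣≡s = refl
  length-concat-tabulate {suc n} f s ∣f∣≡s = trans (length-++ (f Fin.zero))
    (cong₂ _+_ (∣f∣≡s Fin.zero) (length-concat-tabulate (λ j → f (Fin.suc j)) s (λ j → ∣f∣≡s (Fin.suc j))))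

  -- phaseSize i is the common size s_{i+1} of the demand vectors of (i+1)-phases
  phaseSize : ℕ → ℕ
  phaseSize zero    = 1
  phaseSize (suc i) = d (suc (suc i)) * (ratio (suc i) * phaseSize i)

  mutual
    ∣mdem∣≡ : ∀ i {n e H} (Q : Multi (level i) n e H) → ∣ mdem Q ∣ ≡ n * phaseSize i
    ∣mdem∣≡ i Q = length-concat-tabulate _ (phaseSize i) (λ j → ∣dem∣≡phaseSize i (Multi.parts Q j))

    ∣dem∣≡phaseSize : ∀ i {H} (P : Ph (level i) H) → ∣ dem (level i) P ∣ ≡ phaseSize i
    ∣dem∣≡phaseSize zero    P = refl
    ∣dem∣≡phaseSize (suc i) P = begin
        ∣ mdem Q0 ++ concat (tabulate (λ p → mdem (Step.Q P p))) ∣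
      ≡⟨ length-++ (mdem Q0) ⟩
        ∣ mdem Q0 ∣ + ∣ concat (tabulate (λ p → mdem (Step.Q P p))) ∣
      ≡⟨ cong₂ _+_ (∣mdem∣≡ i Q0) (length-concat-tabulate _ _ (λ p → ∣mdem∣≡ i (Step.Q P p))) ⟩
        m + length (Multi.crit Q0) * m
      ≡⟨ cong (λ c → m + c * m) (proj₁ (proj₂ (Multi.crit-top Q0))) ⟩
        m + (d (suc (suc i)) ∸ 1) * m
      ≡⟨ cong (_* m) (m+[n∸m]≡n (d>0 (suc (suc i)))) ⟩
        d (suc (suc i)) * m
      ∎
      where
      open ≡-Reasoning
      Q0 = Step.Q0 P
      m  = ratio (suc i) * phaseSize i

  hard-dem≤ : ∀ {L n e H} (P : Step L n e H) x q →
              mdem (proj₂ (proj₂ (hard P x))) [ q ] ≤ dem (stepLD L n e) P [ q ]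
  hard-dem≤ P nothing q = coord-++-≤ˡ (mdem (Step.Q0 P)) _ q
  hard-dem≤ P (just p) q with p ∈? Multi.crit (Step.Q0 P)
  ... | yes p∈S = ≤-trans (coord-≤-concat-tabulate _ (index p∈S) q) (coord-++-≤ʳ (mdem (Step.Q0 P)) _ q)
  ... | no  _   = coord-++-≤ˡ (mdem (Step.Q0 P)) _ q

  contaminated-parts-bound : ∀ {i n e H} (Q : Multi (level i) n e H) q D
    (J : List (Fin n)) → UniqueP.Unique J →
    All (λ j → phaseSize i ≤ dem (level i) (Multi.parts Q j) [ q ] * D) J →
    length J * phaseSize i ≤ mdem Q [ q ] * D
  contaminated-parts-bound {i} {n} Q q D J J-unique bounds = begin
      length J * phaseSize i
    ≤⟨ length*≤sum-map* g (phaseSize i) D J bounds ⟩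
      sum (map g J) * D
    ≤⟨ *-monoˡ-≤ D (sum-map-mono-⊆ g J-unique (λ {j} _ → ∈-allFin j)) ⟩
      sum (map g (allFin n)) * D
    ≡⟨ cong (λ xs → sum xs * D) (map-tabulate (λ j → j) g) ⟩
      sum (tabulate g) * D
    ≡⟨ cong (_* D) (coord-concat-tabulate (λ j → dem (level i) (Multi.parts Q j)) q) ⟨
      mdem Q [ q ] * D
    ∎
    where
    open ≤-Reasoning
    g : Fin n → ℕ
    g j = dem (level i) (Multi.parts Q j) [ q ]

  nthC-∈ : ∀ C₀ Cs a → nthC C₀ Cs a ≡ C₀ ⊎ nthC C₀ Cs a ∈ Cs
  nthC-∈ C₀ Cs       zero    = inj₁ refl
  nthC-∈ C₀ []       (suc a) = inj₁ refl
  nthC-∈ C₀ (C ∷ Cs) (suc a) with nthC-∈ C Cs a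
  ... | inj₁ eq = inj₂ (here eq)
  ... | inj₂ m  = inj₂ (there m)

  Active⇒lookup-nthC : ∀ {t C₀ Cs} a → Active t C₀ Cs → (j : Fin k) → t ≤ toℕ j →
                       Vec.lookup (nthC C₀ Cs a) j ≡ Vec.lookup C₀ j
  Active⇒lookup-nthC {C₀ = C₀} {Cs} a active j t≤j with nthC-∈ C₀ Cs a
  ... | inj₁ eq = cong (λ C → Vec.lookup C j) eq
  ... | inj₂ m  = active _ m j t≤j

  contaminated-bound : ∀ i {H} (P : Ph (level i) H) C₀ Cs → Active i C₀ Cs →
    (ℓ' : Fin k) → suc i ≤ toℕ ℓ' → contam ℓ' i P C₀ Cs →
    phaseSize i ≤ dem (level i) P [ Vec.lookup C₀ ℓ' ] * (d (suc i) * F (suc i) (suc (toℕ ℓ')))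
  contaminated-bound zero P C₀ Cs _ ℓ' _ v[q]≡1 rewrite v[q]≡1 = ≤-refl
  contaminated-bound (suc i) P C₀ Cs active ℓ' i<ℓ' c
    with hard P (at (Vec.toList C₀) (suc i)) | hard-dem≤ P (at (Vec.toList C₀) (suc i)) (Vec.lookup C₀ ℓ')
  ... | _ , off , Qh | Qh≤P with c
  ... | J , J-unique , J-contaminated , n≤|J|T =
    contamination-arithmetic {j = length J} {T = T} {V = V}
      (d (suc (suc i))) (d (suc i)) (F (suc i) (suc (toℕ ℓ'))) n≤|J|T |J|s≤VD
    where
    q = Vec.lookup C₀ ℓ'
    V = dem (level (suc i)) P [ q ]
    T = 2 ^ (suc (toℕ ℓ') ∸ suc (suc i) + 3)
    D = d (suc i) * F (suc i) (suc (toℕ ℓ'))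

    -- the start of the j-th constituent phase, exactly as in the definition of contam
    offset : Fin (ratio (suc i)) → ℕ
    offset j = off + length (concat (take (toℕ j) (reqsOf (level i) (Multi.parts Qh))))

    part-bound : ∀ {j} a Cs' → Active i (nthC C₀ Cs a) Cs' →
                 contam ℓ' i (Multi.parts Qh j) (nthC C₀ Cs a) Cs' →
                 phaseSize i ≤ dem (level i) (Multi.parts Qh j) [ q ] * D
    part-bound {j} a Cs' active' c' =
      subst (λ p → phaseSize i ≤ dem (level i) (Multi.parts Qh j) [ p ] * D)
        (Active⇒lookup-nthC a active ℓ' (<⇒≤ i<ℓ'))
        (contaminated-bound i (Multi.parts Qh j) _ Cs' active' ℓ' (<⇒≤ i<ℓ') c')

    |J|s≤VD : length J * phaseSize i ≤ V * D
    |J|s≤VD = ≤-trans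
      (contaminated-parts-bound {i = i} Qh q D J J-unique
        (All.map (λ {j} h → part-bound (offset j) _ (proj₁ h) (proj₂ h)) J-contaminated))
      (*-monoˡ-≤ D Qh≤P)

lemma34 : (𝒮 : Setting) → let open Setup 𝒮 in
    (ℓ : ℕ) → 1 ≤ ℓ → ℓ ≤ k →
    (H : List M) → Unique H → length H ≤ k ∸ ℓ →
    (P : Phase ℓ H) →
    (C₀ : Config) (Cs : List Config) →
    IsSolution (requests ℓ P) C₀ Cs → Active (ℓ ∸ 1) C₀ Cs →
    (ℓ' : Fin k) → ℓ < suc (toℕ ℓ') →
    Contaminated ℓ' ℓ P C₀ Cs →
    ∣ demand ℓ P ∣ ≤ (demand ℓ P [ Vec.lookup C₀ ℓ' ]) * (d ℓ * F ℓ (suc (toℕ ℓ')))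
lemma34 𝒮 (suc i) _ _ _ _ _ P C₀ Cs _ active ℓ' ℓ<ℓ' c =
  ≤-trans (≤-reflexive (∣dem∣≡phaseSize 𝒮 i P)) (contaminated-bound 𝒮 i P C₀ Cs active ℓ' (≤-pred ℓ<ℓ') c)
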